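{- Let $l\ge 1$ and let $d_1,\dots,d_l$ be nonnegative integers with $d=d_1+\cdots+d_l\ge 1$. For $1\le k\le d$ let ${\mathbf{d}\brace k}_O$ denote the number of ordered partitions of the multiset $S(\mathbf{d})$ into $k$ nonempty multisets. Then, as an identity of polynomials in $x$, $$\prod_{j=1}^l\binom{x+d_j}{d_j}=\sum_{k=1}^d{\mathbf{d}\brace k}_O\binom{x+1}{k}.$$
   Context: For $\mathbf{d}=(d_1,\dots,d_l)$, $S(\mathbf{d})$ is the multiset containing $j$ with multiplicity $d_j$ for each $j\in\{1,\dots,l\}$. An ordered partition of $S(\mathbf{d})$ into $k$ nonempty multisets is a sequence $(S_1,\dots,S_k)$ of nonempty submultisets whose multiset union (sum of multiplicities) is $S(\mathbf{d})$; equivalently, a sequence of vectors $\mathbf{0}=\mathbf{v}_0<\mathbf{v}_1<\cdots<\mathbf{v}_k=(d_1,\dots,d_l)$ in $\mathbb{Z}_{\ge0}^l$ strictly increasing in the componentwise partial order (with $\mathbf{v}_{h}\neq\mathbf{v}_{h+1}$). When all $d_j=1$, ${\mathbf{d}\brace k}_O=k!{l\brace k}$. -}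

module Defs where

open import Data.Nat using (ℕ; zero; suc; _+_; _*_)
import Data.Nat as ℕ
open import Data.List as List using (List; []; _∷_; concatMap; upTo; length; filter)
open import Data.Vec as Vec using (Vec; []; _∷_; replicate; zipWith; foldr)
import Data.Vec.Properties as VecP
open import Data.Product using (_×_; _,_)
open import Relation.Nullary using (Dec; ¬_; yes; no)
open import Relation.Nullary.Decidable using (_×-dec_; ¬?)
open import Relation.Binary.PropositionalEquality using (_≡_)
open import Data.Vec.Relation.Unary.All as VAll using (All)

-- A submultiset of S(d) (d ∈ ℕ^l) is encoded by its multiplicity vector v ≤ d.
-- box d lists every vector v ∈ ℕ^l with v ≤ d componentwise (each exactly once).
box : ∀ {l} → Vec ℕ l → List (Vec ℕ l)
box []       = [] ∷ []
box (dj ∷ ds) = concatMap (λ a → List.map (a ∷_) (box ds)) (upTo (suc dj))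

tuples : ∀ {A : Set} (k : ℕ) → List A → List (Vec A k)
tuples zero    xs = [] ∷ []
tuples (suc k) xs = concatMap (λ x → List.map (x ∷_) (tuples k xs)) xs

zeroV : ∀ l → Vec ℕ l
zeroV l = replicate l 0

-- multiset union = componentwise sum of multiplicity vectors
vsum : ∀ {l k} → Vec (Vec ℕ l) k → Vec ℕ l
vsum {l} = foldr _ (zipWith _+_) (zeroV l)

_≟V_ : ∀ {l} (u v : Vec ℕ l) → Dec (u ≡ v)
_≟V_ = VecP.≡-dec ℕ._≟_

allNonempty? : ∀ {l k} (s : Vec (Vec ℕ l) k) → Dec (All (λ v → ¬ (v ≡ zeroV l)) s)
allNonempty? {l} s = VAll.all? (λ v → ¬? (v ≟V zeroV l)) s

IsOrdPart : ∀ {l k} → Vec ℕ l → Vec (Vec ℕ l) k → Set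
IsOrdPart {l} d s = All (λ v → ¬ (v ≡ zeroV l)) s × (vsum s ≡ d)

isOrdPart? : ∀ {l k} (d : Vec ℕ l) (s : Vec (Vec ℕ l) k) → Dec (IsOrdPart d s)
isOrdPart? d s = allNonempty? s ×-dec (vsum s ≟V d)

-- {d brace k}_O : number of ordered partitions of S(d) into k nonempty multisets
-- (every part is a submultiset of S(d), hence all candidates lie in box d)
ordStirling : ∀ {l} → Vec ℕ l → ℕ → ℕ
ordStirling d k = length (filter (isOrdPart? d) (tuples k (box d)))

-- Put n = x + 1 and count W(d, n), the n-tuples of submultisets of S(d) whose union is S(d)
-- (empty parts allowed). Coordinatewise, W(d, n) is a product of stars-and-bars counts
-- C(x + d_j, d_j). Alternatively, choosing which k of the n parts are nonempty gives
-- W(d, n) = Σ_k C(n, k) {d brace k}_O, and C(n, k) = C(x + 1, k).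
module Submission where

open import Defs
open import Data.Bool using (if_then_else_; true; false)
open import Data.Empty using (⊥-elim)
open import Data.List as List using (List; []; _∷_; _++_; map; upTo; concatMap; applyUpTo; filter; length)
open import Data.List.Properties using (map-++; map-∘; map-cong)
open import Data.List.Relation.Unary.All as All using (All; []; _∷_)
open import Data.List.Relation.Unary.All.Properties using (map⁺; ++⁺; concat⁺; applyUpTo⁺₂)
open import Data.Nat using (ℕ; zero; suc; _+_; _*_; _≤_; _<_; _≥_; z≤n; s≤s)
open import Data.Nat.Combinatorics using (_C_; k>n⇒nCk≡0; nCn≡1; nCk+nC[k+1]≡[n+1]C[k+1])
open import Data.Nat.ListAction using (sum; product)
open import Data.Nat.ListAction.Properties using (sum-++)
open import Data.Nat.Properties
open import Algebra.Properties.CommutativeSemigroup +-commutativeSemigroup using (interchange)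
open import Data.Sum using (inj₁; inj₂)
open import Data.Vec using (Vec; []; _∷_; toList; zipWith; replicate)
import Data.Vec as Vec
open import Data.Vec.Properties using (zipWith-identityˡ)
import Data.Vec.Relation.Unary.All as VecAll
open import Function using (_∘_; id)
open import Relation.Binary.PropositionalEquality using (_≡_; refl; sym; trans; cong; cong₂; subst)
open import Relation.Nullary using (Dec; does; yes; no; ¬_)
open import Relation.Nullary.Decidable using (_×-dec_)
open Relation.Binary.PropositionalEquality.≡-Reasoning

variable
  A B : Set
  l : ℕ

𝟙 : ∀ {p} {P : Set p} → Dec P → ℕ
𝟙 d = if does d then 1 else 0

𝟙-no : ∀ {p} {P : Set p} (d : Dec P) → ¬ P → 𝟙 d ≡ 0
𝟙-no (yes p) ¬p = ⊥-elim (¬p p)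
𝟙-no (no _)  ¬p = refl

𝟙-⇔ : ∀ {p q} {P : Set p} {Q : Set q} (d : Dec P) (e : Dec Q) → (P → Q) → (Q → P) → 𝟙 d ≡ 𝟙 e
𝟙-⇔ (yes _) (yes _) _ _ = refl
𝟙-⇔ (yes p) (no ¬q) f _ = ⊥-elim (¬q (f p))
𝟙-⇔ (no ¬p) (yes q) _ g = ⊥-elim (¬p (g q))
𝟙-⇔ (no _)  (no _)  _ _ = refl

𝟙-× : ∀ {p q} {P : Set p} {Q : Set q} (d : Dec P) (e : Dec Q) → 𝟙 (d ×-dec e) ≡ 𝟙 d * 𝟙 e
𝟙-× (yes _) e = sym (+-identityʳ (𝟙 e))
𝟙-× (no _)  e = refl

∑ : List A → (A → ℕ) → ℕ
∑ xs f = sum (map f xs)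

infix 5 ∑
syntax ∑ xs (λ x → e) = ∑[ x ∈ xs ] e

length-filter : {P : A → Set} (P? : ∀ x → Dec (P x)) (xs : List A) →
  length (filter P? xs) ≡ ∑[ x ∈ xs ] 𝟙 (P? x)
length-filter P? []       = refl
length-filter P? (x ∷ xs) with does (P? x)
... | true  = cong suc (length-filter P? xs)
... | false = length-filter P? xs

∑-cong : (xs : List A) {f g : A → ℕ} → (∀ x → f x ≡ g x) → ∑ xs f ≡ ∑ xs g
∑-cong xs f≗g = cong sum (map-cong f≗g xs)

∑-congᴬ : {P : A → Set} {xs : List A} {f g : A → ℕ} → All P xs →
  (∀ x → P x → f x ≡ g x) → ∑ xs f ≡ ∑ xs g
∑-congᴬ []       e = refl
∑-congᴬ (p ∷ ps) e = cong₂ _+_ (e _ p) (∑-congᴬ ps e)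

∑-zero : (xs : List A) {f : A → ℕ} → (∀ x → f x ≡ 0) → ∑ xs f ≡ 0
∑-zero []       e = refl
∑-zero (x ∷ xs) e = cong₂ _+_ (e x) (∑-zero xs e)

∑-zeroᴬ : {P : A → Set} {xs : List A} {f : A → ℕ} → All P xs → (∀ x → P x → f x ≡ 0) → ∑ xs f ≡ 0
∑-zeroᴬ {xs = xs} ps e = trans (∑-congᴬ ps e) (∑-zero xs (λ _ → refl))

∑-++ : (xs ys : List A) (f : A → ℕ) → ∑ (xs ++ ys) f ≡ ∑ xs f + ∑ ys f
∑-++ xs ys f = trans (cong sum (map-++ f xs ys)) (sum-++ (map f xs) (map f ys))

∑-map : (xs : List A) (g : A → B) (f : B → ℕ) → ∑ (map g xs) f ≡ ∑[ x ∈ xs ] f (g x)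
∑-map xs g f = cong sum (sym (map-∘ xs))

∑-concatMap : (xs : List A) (g : A → List B) (f : B → ℕ) → ∑ (concatMap g xs) f ≡ ∑[ x ∈ xs ] ∑ (g x) f
∑-concatMap []       g f = refl
∑-concatMap (x ∷ xs) g f = trans (∑-++ (g x) (concatMap g xs) f) (cong (∑ (g x) f +_) (∑-concatMap xs g f))

∑-+ : (xs : List A) (f g : A → ℕ) → ∑[ x ∈ xs ] (f x + g x) ≡ ∑ xs f + ∑ xs g
∑-+ []       f g = refl
∑-+ (x ∷ xs) f g = trans (cong (f x + g x +_) (∑-+ xs f g)) (interchange (f x) (g x) _ _)

∑-*ˡ : (xs : List A) (c : ℕ) (f : A → ℕ) → ∑[ x ∈ xs ] c * f x ≡ c * ∑ xs f
∑-*ˡ []       c f = sym (*-zeroʳ c)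
∑-*ˡ (x ∷ xs) c f = trans (cong (c * f x +_) (∑-*ˡ xs c f)) (sym (*-distribˡ-+ c (f x) _))

∑-*ʳ : (xs : List A) (c : ℕ) (f : A → ℕ) → ∑[ x ∈ xs ] f x * c ≡ ∑ xs f * c
∑-*ʳ xs c f = trans (∑-cong xs (λ x → *-comm (f x) c)) (trans (∑-*ˡ xs c f) (*-comm c _))

∑-comm : (xs : List A) (ys : List B) (f : A → B → ℕ) →
  ∑[ x ∈ xs ] ∑ ys (f x) ≡ ∑[ y ∈ ys ] ∑[ x ∈ xs ] f x y
∑-comm []       ys f = sym (∑-zero ys (λ _ → refl))
∑-comm (x ∷ xs) ys f = trans (cong (∑ ys (f x) +_) (∑-comm xs ys f)) (sym (∑-+ ys (f x) _))

∑< : ℕ → (ℕ → ℕ) → ℕ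
∑< zero    f = 0
∑< (suc m) f = f 0 + ∑< m (f ∘ suc)

infix 5 ∑<
syntax ∑< m (λ k → e) = ∑[ k < m ] e

∑<-cong : ∀ m {f g : ℕ → ℕ} → (∀ k → f k ≡ g k) → ∑< m f ≡ ∑< m g
∑<-cong zero    e = refl
∑<-cong (suc m) e = cong₂ _+_ (e 0) (∑<-cong m (e ∘ suc))

∑<-zero : ∀ m {f : ℕ → ℕ} → (∀ k → f k ≡ 0) → ∑< m f ≡ 0
∑<-zero zero    e = refl
∑<-zero (suc m) e = cong₂ _+_ (e 0) (∑<-zero m (e ∘ suc))

∑<-+ : ∀ m (f g : ℕ → ℕ) → ∑[ k < m ] (f k + g k) ≡ ∑< m f + ∑< m g
∑<-+ zero    f g = refl
∑<-+ (suc m) f g = trans (cong (f 0 + g 0 +_) (∑<-+ m _ _)) (interchange (f 0) (g 0) _ _)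

∑<-extend : ∀ m m' (f : ℕ → ℕ) → m ≤ m' → (∀ k → m ≤ k → f k ≡ 0) → ∑< m' f ≡ ∑< m f
∑<-extend zero    m'       f _         e = ∑<-zero m' (λ k → e k z≤n)
∑<-extend (suc m) (suc m') f (s≤s m≤m') e = cong (f 0 +_) (∑<-extend m m' _ m≤m' (λ k → e (suc k) ∘ s≤s))

∑<-support : ∀ m m' (f : ℕ → ℕ) → (∀ k → m ≤ k → f k ≡ 0) → (∀ k → m' ≤ k → f k ≡ 0) → ∑< m f ≡ ∑< m' f
∑<-support m m' f e e' with ≤-total m m'
... | inj₁ m≤m' = sym (∑<-extend m m' f m≤m' e)
... | inj₂ m'≤m = ∑<-extend m' m f m'≤m e'

∑-∑<-comm : (xs : List A) (m : ℕ) (f : A → ℕ → ℕ) → ∑[ x ∈ xs ] ∑< m (f x) ≡ ∑[ k < m ] ∑[ x ∈ xs ] f x k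
∑-∑<-comm []       m f = sym (∑<-zero m (λ _ → refl))
∑-∑<-comm (x ∷ xs) m f = trans (cong (∑< m (f x) +_) (∑-∑<-comm xs m f)) (sym (∑<-+ m (f x) _))

∑-applyUpTo : ∀ m (g : ℕ → ℕ) (f : ℕ → ℕ) → ∑ (applyUpTo g m) f ≡ ∑[ k < m ] f (g k)
∑-applyUpTo zero    g f = refl
∑-applyUpTo (suc m) g f = cong (f (g 0) +_) (∑-applyUpTo m (g ∘ suc) f)

∑-pascal : ∀ n (a : ℕ → ℕ) →
  (∑[ k < suc n ] (n C k) * a k) + (∑[ k < suc n ] (n C k) * a (suc k)) ≡ ∑[ k < suc (suc n) ] (suc n C k) * a k
∑-pascal n a = begin
  (a₀ + ∑< n g) + S
    ≡⟨ cong (λ t → a₀ + t + S) (sym (∑<-extend n (suc n) g (n≤1+n n) g-vanishes)) ⟩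
  (a₀ + ∑< (suc n) g) + S
    ≡⟨ +-assoc a₀ _ S ⟩
  a₀ + (∑< (suc n) g + S)
    ≡⟨ cong (a₀ +_) (+-comm (∑< (suc n) g) S) ⟩
  a₀ + (S + ∑< (suc n) g)
    ≡⟨ cong (a₀ +_) (sym (∑<-+ (suc n) (λ k → (n C k) * a (suc k)) g)) ⟩
  a₀ + (∑[ k < suc n ] ((n C k) * a (suc k) + (n C suc k) * a (suc k)))
    ≡⟨ cong (a₀ +_) (∑<-cong (suc n) pascal) ⟩
  a₀ + (∑[ k < suc n ] (suc n C suc k) * a (suc k)) ∎
  where
  a₀ = 1 * a 0
  g : ℕ → ℕ
  g k = (n C suc k) * a (suc k)
  S = ∑[ k < suc n ] (n C k) * a (suc k)
  g-vanishes : ∀ k → n ≤ k → g k ≡ 0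
  g-vanishes k n≤k = cong (_* a (suc k)) (k>n⇒nCk≡0 (s≤s n≤k))
  pascal : ∀ k → (n C k) * a (suc k) + (n C suc k) * a (suc k) ≡ (suc n C suc k) * a (suc k)
  pascal k = trans (sym (*-distribʳ-+ (a (suc k)) (n C k) (n C suc k)))
                   (cong (_* a (suc k)) (nCk+nC[k+1]≡[n+1]C[k+1] n k))

∑-tuples : ∀ k (xs : List A) (f : Vec A (suc k) → ℕ) →
  ∑ (tuples (suc k) xs) f ≡ ∑[ x ∈ xs ] ∑[ s ∈ tuples k xs ] f (x ∷ s)
∑-tuples k xs f = trans (∑-concatMap xs _ f) (∑-cong xs (λ x → ∑-map (tuples k xs) (x ∷_) f))

-- A k-tuple over a list of pairs (a, v), encoded as a ∷ v, is a pair of k-tuples.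
∑-tuples-∷ : ∀ k (xs : List ℕ) (vs : List (Vec ℕ l)) (f : Vec (Vec ℕ (suc l)) k → ℕ) →
  ∑ (tuples k (concatMap (λ a → map (a ∷_) vs) xs)) f ≡
  ∑[ a ∈ tuples k xs ] ∑[ t ∈ tuples k vs ] f (zipWith _∷_ a t)
∑-tuples-∷ zero    xs vs f = sym (+-identityʳ _)
∑-tuples-∷ (suc k) xs vs f = begin
  ∑ (tuples (suc k) ys) f
    ≡⟨ ∑-tuples k ys f ⟩
  ∑[ y ∈ ys ] ∑[ s ∈ tuples k ys ] f (y ∷ s)
    ≡⟨ ∑-concatMap xs (λ a → map (a ∷_) vs) _ ⟩
  ∑[ a ∈ xs ] ∑[ y ∈ map (a ∷_) vs ] ∑[ s ∈ tuples k ys ] f (y ∷ s)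
    ≡⟨ ∑-cong xs (λ a → ∑-map vs (a ∷_) _) ⟩
  ∑[ a ∈ xs ] ∑[ v ∈ vs ] ∑[ s ∈ tuples k ys ] f ((a ∷ v) ∷ s)
    ≡⟨ ∑-cong xs (λ a → ∑-cong vs (λ v → ∑-tuples-∷ k xs vs (λ s → f ((a ∷ v) ∷ s)))) ⟩
  ∑[ a ∈ xs ] ∑[ v ∈ vs ] ∑[ as ∈ tuples k xs ] ∑[ t ∈ tuples k vs ] f ((a ∷ v) ∷ zipWith _∷_ as t)
    ≡⟨ ∑-cong xs (λ a → ∑-comm vs (tuples k xs) _) ⟩
  ∑[ a ∈ xs ] ∑[ as ∈ tuples k xs ] ∑[ v ∈ vs ] ∑[ t ∈ tuples k vs ] f ((a ∷ v) ∷ zipWith _∷_ as t)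
    ≡⟨ ∑-cong xs (λ a → ∑-cong (tuples k xs) (λ as → sym (∑-tuples k vs _))) ⟩
  ∑[ a ∈ xs ] ∑[ as ∈ tuples k xs ] ∑[ t ∈ tuples (suc k) vs ] f (zipWith _∷_ (a ∷ as) t)
    ≡⟨ sym (∑-tuples k xs _) ⟩
  ∑[ a ∈ tuples (suc k) xs ] ∑[ t ∈ tuples (suc k) vs ] f (zipWith _∷_ a t) ∎
  where ys = concatMap (λ a → map (a ∷_) vs) xs

tuples-singleton : ∀ k (x : A) → tuples k (x ∷ []) ≡ replicate k x ∷ []
tuples-singleton zero    x = refl
tuples-singleton (suc k) x = cong (λ ts → map (x ∷_) ts ++ []) (tuples-singleton k x)

vsum-zipWith-∷ : ∀ {k} (a : Vec ℕ k) (t : Vec (Vec ℕ l) k) → vsum (zipWith _∷_ a t) ≡ Vec.sum a ∷ vsum t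
vsum-zipWith-∷ []       []       = refl
vsum-zipWith-∷ (a ∷ as) (v ∷ t) = cong (zipWith _+_ (a ∷ v)) (vsum-zipWith-∷ as t)

sum-zipWith-+ : (u v : Vec ℕ l) → Vec.sum (zipWith _+_ u v) ≡ Vec.sum u + Vec.sum v
sum-zipWith-+ []       []       = refl
sum-zipWith-+ (a ∷ u) (b ∷ v) = trans (cong (a + b +_) (sum-zipWith-+ u v)) (interchange a b _ _)

sum-zeroV : ∀ l → Vec.sum (zeroV l) ≡ 0
sum-zeroV zero    = refl
sum-zeroV (suc l) = sum-zeroV l

boundedCompositions : ℕ → ℕ → ℕ → ℕ
boundedCompositions c k e = ∑[ a ∈ tuples k (upTo (suc c)) ] 𝟙 (Vec.sum a ≟ e)

weakCompositions : Vec ℕ l → ℕ → ℕ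
weakCompositions d k = ∑[ s ∈ tuples k (box d) ] 𝟙 (vsum s ≟V d)

weakCompositions-[] : ∀ k → weakCompositions [] k ≡ 1
weakCompositions-[] k =
  trans (cong (λ ts → ∑[ s ∈ ts ] 𝟙 (vsum s ≟V [])) (tuples-singleton k [])) (𝟙-[] (vsum (replicate k [])))
  where
  𝟙-[] : (u : Vec ℕ 0) → 𝟙 (u ≟V []) + 0 ≡ 1
  𝟙-[] [] = refl

weakCompositions-∷ : ∀ c (d : Vec ℕ l) k →
  weakCompositions (c ∷ d) k ≡ boundedCompositions c k c * weakCompositions d k
weakCompositions-∷ c d k = begin
  weakCompositions (c ∷ d) k
    ≡⟨ ∑-tuples-∷ k U (box d) _ ⟩
  ∑[ a ∈ tuples k U ] ∑[ t ∈ tuples k (box d) ] 𝟙 (vsum (zipWith _∷_ a t) ≟V (c ∷ d))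
    ≡⟨ ∑-cong (tuples k U) (λ a → ∑-cong (tuples k (box d)) (λ t →
         trans (cong (λ u → 𝟙 (u ≟V (c ∷ d))) (vsum-zipWith-∷ a t)) (𝟙-× (Vec.sum a ≟ c) (vsum t ≟V d)))) ⟩
  ∑[ a ∈ tuples k U ] ∑[ t ∈ tuples k (box d) ] 𝟙 (Vec.sum a ≟ c) * 𝟙 (vsum t ≟V d)
    ≡⟨ ∑-cong (tuples k U) (λ a → ∑-*ˡ (tuples k (box d)) (𝟙 (Vec.sum a ≟ c)) _) ⟩
  ∑[ a ∈ tuples k U ] 𝟙 (Vec.sum a ≟ c) * weakCompositions d k
    ≡⟨ ∑-*ʳ (tuples k U) (weakCompositions d k) _ ⟩
  boundedCompositions c k c * weakCompositions d k ∎
  where U = upTo (suc c)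

weakCompositions≡product : (d : Vec ℕ l) (k : ℕ) →
  weakCompositions d k ≡ product (map (λ c → boundedCompositions c k c) (toList d))
weakCompositions≡product []      k = weakCompositions-[] k
weakCompositions≡product (c ∷ d) k =
  trans (weakCompositions-∷ c d k) (cong (boundedCompositions c k c *_) (weakCompositions≡product d k))

-- counts the (k+1)-tuples of boundedCompositions c (suc k) e whose first entry is a
shiftedCompositions : ℕ → ℕ → ℕ → ℕ → ℕ
shiftedCompositions c k a e = ∑[ t ∈ tuples k (upTo (suc c)) ] 𝟙 (a + Vec.sum t ≟ e)

boundedCompositions-suc : ∀ c k e →
  boundedCompositions c (suc k) e ≡ boundedCompositions c k e + (∑[ a < c ] shiftedCompositions c k (suc a) e)
boundedCompositions-suc c k e =
  trans (∑-tuples k (upTo (suc c)) _) (∑-applyUpTo (suc c) id (λ a → shiftedCompositions c k a e))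

boundedCompositions-zero : ∀ c k → boundedCompositions c (suc k) 0 ≡ boundedCompositions c k 0
boundedCompositions-zero c k = begin
  boundedCompositions c (suc k) 0 ≡⟨ boundedCompositions-suc c k 0 ⟩
  boundedCompositions c k 0 + (∑[ a < c ] shiftedCompositions c k (suc a) 0)
    ≡⟨ cong (boundedCompositions c k 0 +_) (∑<-zero c (λ a →
         ∑-zero (tuples k (upTo (suc c))) (λ t → 𝟙-no (suc a + Vec.sum t ≟ 0) (λ ())))) ⟩
  boundedCompositions c k 0 + 0   ≡⟨ +-identityʳ _ ⟩
  boundedCompositions c k 0 ∎

-- Split on whether the first entry is 0 and lower a positive one by 1; it cannot be c since e < c.
boundedCompositions-pascal : ∀ c k e → e < c →
  boundedCompositions c (suc k) (suc e) ≡ boundedCompositions c k (suc e) + boundedCompositions c (suc k) e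
boundedCompositions-pascal c k e e<c = begin
  boundedCompositions c (suc k) (suc e)
    ≡⟨ boundedCompositions-suc c k (suc e) ⟩
  boundedCompositions c k (suc e) + (∑[ a < c ] shiftedCompositions c k (suc a) (suc e))
    ≡⟨ cong (boundedCompositions c k (suc e) +_) (∑<-cong c (λ a →
         ∑-cong (tuples k U) (λ t → 𝟙-⇔ (suc a + Vec.sum t ≟ suc e) (a + Vec.sum t ≟ e) suc-injective (cong suc)))) ⟩
  boundedCompositions c k (suc e) + (∑[ a < c ] shiftedCompositions c k a e)
    ≡⟨ cong (boundedCompositions c k (suc e) +_) (sym top-vanishes) ⟩
  boundedCompositions c k (suc e) + (∑[ a < suc c ] shiftedCompositions c k a e)
    ≡⟨ cong (boundedCompositions c k (suc e) +_) (sym (boundedCompositions-suc c k e)) ⟩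
  boundedCompositions c k (suc e) + boundedCompositions c (suc k) e ∎
  where
  U = upTo (suc c)
  top-vanishes : ∑[ a < suc c ] shiftedCompositions c k a e ≡ ∑[ a < c ] shiftedCompositions c k a e
  top-vanishes = ∑<-extend c (suc c) _ (n≤1+n c) (λ a c≤a →
    ∑-zero (tuples k U) (λ t → 𝟙-no (a + Vec.sum t ≟ e)
      (λ eq → <⇒≱ e<c (≤-trans c≤a (subst (a ≤_) eq (m≤m+n a _))))))

boundedCompositions≡C : ∀ x c e → e ≤ c → boundedCompositions c (suc x) e ≡ (x + e) C e
boundedCompositions≡C zero    c zero    _   = boundedCompositions-zero c 0
boundedCompositions≡C zero    c (suc e) e<c = begin
  boundedCompositions c 1 (suc e)
    ≡⟨ boundedCompositions-pascal c 0 e e<c ⟩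
  boundedCompositions c 0 (suc e) + boundedCompositions c 1 e
    ≡⟨⟩
  boundedCompositions c 1 e
    ≡⟨ boundedCompositions≡C zero c e (<⇒≤ e<c) ⟩
  e C e
    ≡⟨ trans (nCn≡1 e) (sym (nCn≡1 (suc e))) ⟩
  suc e C suc e ∎
boundedCompositions≡C (suc x) c zero    _   =
  trans (boundedCompositions-zero c (suc x)) (boundedCompositions≡C x c 0 z≤n)
boundedCompositions≡C (suc x) c (suc e) e<c = begin
  boundedCompositions c (suc (suc x)) (suc e)
    ≡⟨ boundedCompositions-pascal c (suc x) e e<c ⟩
  boundedCompositions c (suc x) (suc e) + boundedCompositions c (suc (suc x)) e
    ≡⟨ cong₂ _+_ (boundedCompositions≡C x c (suc e) e<c) (boundedCompositions≡C (suc x) c e (<⇒≤ e<c)) ⟩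
  (x + suc e) C suc e + (suc x + e) C e
    ≡⟨ +-comm ((x + suc e) C suc e) _ ⟩
  (suc x + e) C e + (x + suc e) C suc e
    ≡⟨ cong (λ m → m C e + (x + suc e) C suc e) (sym (+-suc x e)) ⟩
  (x + suc e) C e + (x + suc e) C suc e
    ≡⟨ nCk+nC[k+1]≡[n+1]C[k+1] (x + suc e) e ⟩
  suc (x + suc e) C suc e ∎

Nonempty : Vec ℕ l → Set
Nonempty v = 1 ≤ Vec.sum v

Nonempty⇒≢zeroV : (v : Vec ℕ l) → Nonempty v → ¬ v ≡ zeroV l
Nonempty⇒≢zeroV {l} v 1≤v refl = <⇒≱ 1≤v (≤-reflexive (sum-zeroV l))

box⁺ : Vec ℕ l → List (Vec ℕ l)
box⁺ []      = []
box⁺ (c ∷ d) = map (0 ∷_) (box⁺ d) ++ concatMap (λ a → map (a ∷_) (box d)) (applyUpTo suc c)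

box≡zeroV∷box⁺ : (d : Vec ℕ l) → box d ≡ zeroV l ∷ box⁺ d
box≡zeroV∷box⁺ []      = refl
box≡zeroV∷box⁺ (c ∷ d) = cong (λ vs → map (0 ∷_) vs ++ concatMap (λ a → map (a ∷_) (box d)) (applyUpTo suc c))
                               (box≡zeroV∷box⁺ d)

box⁺-nonempty : (d : Vec ℕ l) → All Nonempty (box⁺ d)
box⁺-nonempty []      = []
box⁺-nonempty (c ∷ d) = ++⁺ (map⁺ (box⁺-nonempty d))
  (concat⁺ (map⁺ (applyUpTo⁺₂ suc c (λ _ → map⁺ (All.universal (λ _ → s≤s z≤n) (box d))))))

∑-tuples-nonempty : ∀ k (vs : List (Vec ℕ l)) → All Nonempty vs → (f : Vec (Vec ℕ l) k → ℕ) →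
  ∑[ s ∈ tuples k (zeroV l ∷ vs) ] 𝟙 (allNonempty? s) * f s ≡ ∑ (tuples k vs) f
∑-tuples-nonempty zero          vs nz f = cong (_+ 0) (*-identityˡ (f []))
∑-tuples-nonempty {l} (suc k) vs nz f = begin
  ∑[ s ∈ tuples (suc k) (z ∷ vs) ] 𝟙 (allNonempty? s) * f s
    ≡⟨ ∑-tuples k (z ∷ vs) _ ⟩
  (∑[ s ∈ tuples k (z ∷ vs) ] 𝟙 (allNonempty? (z ∷ s)) * f (z ∷ s))
    + (∑[ v ∈ vs ] ∑[ s ∈ tuples k (z ∷ vs) ] 𝟙 (allNonempty? (v ∷ s)) * f (v ∷ s))
    ≡⟨ cong₂ _+_ (∑-zero (tuples k (z ∷ vs)) (λ s → cong (_* f (z ∷ s)) (zero-part s)))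
                 (∑-congᴬ nz (λ v v≠0 → trans
                   (∑-cong (tuples k (z ∷ vs)) (λ s → cong (_* f (v ∷ s)) (nonempty-part v v≠0 s)))
                   (∑-tuples-nonempty k vs nz (f ∘ (v ∷_))))) ⟩
  0 + (∑[ v ∈ vs ] ∑[ s ∈ tuples k vs ] f (v ∷ s))
    ≡⟨ sym (∑-tuples k vs f) ⟩
  ∑ (tuples (suc k) vs) f ∎
  where
  z = zeroV l
  zero-part : (s : Vec (Vec ℕ l) k) → 𝟙 (allNonempty? (z ∷ s)) ≡ 0
  zero-part s = 𝟙-no (allNonempty? (z ∷ s)) (λ nz-z∷s → VecAll.head nz-z∷s refl)
  nonempty-part : ∀ v → Nonempty v → (s : Vec (Vec ℕ l) k) → 𝟙 (allNonempty? (v ∷ s)) ≡ 𝟙 (allNonempty? s)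
  nonempty-part v v≠0 s = 𝟙-⇔ (allNonempty? (v ∷ s)) (allNonempty? s) VecAll.tail (Nonempty⇒≢zeroV v v≠0 VecAll.∷_)

∑-tuples-zeroV∷ : ∀ n (vs : List (Vec ℕ l)) (g : Vec ℕ l → ℕ) →
  ∑[ s ∈ tuples n (zeroV l ∷ vs) ] g (vsum s) ≡ ∑[ k < suc n ] (n C k) * (∑[ t ∈ tuples k vs ] g (vsum t))
∑-tuples-zeroV∷     zero    vs g = cong (_+ 0) (trans (sym (+-identityʳ _)) (sym (*-identityˡ _)))
∑-tuples-zeroV∷ {l} (suc n) vs g = begin
  ∑[ s ∈ tuples (suc n) (z ∷ vs) ] g (vsum s)
    ≡⟨ ∑-tuples n (z ∷ vs) _ ⟩
  (∑[ s ∈ tuples n (z ∷ vs) ] g (zipWith _+_ z (vsum s))) + (∑[ v ∈ vs ] ∑[ s ∈ tuples n (z ∷ vs) ] g (v +ᵛ vsum s))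
    ≡⟨ cong₂ _+_ (trans (∑-cong (tuples n (z ∷ vs)) (λ s → cong g (zipWith-identityˡ +-identityˡ (vsum s))))
                        (∑-tuples-zeroV∷ n vs g))
                 (∑-cong vs (λ v → ∑-tuples-zeroV∷ n vs (g ∘ (v +ᵛ_)))) ⟩
  (∑[ k < suc n ] (n C k) * a k) + (∑[ v ∈ vs ] ∑[ k < suc n ] (n C k) * (∑[ t ∈ tuples k vs ] g (v +ᵛ vsum t)))
    ≡⟨ cong ((∑[ k < suc n ] (n C k) * a k) +_) (trans (∑-∑<-comm vs (suc n) (λ v k → (n C k) * b v k)) (∑<-cong (suc n) (λ k →
         trans (∑-*ˡ vs (n C k) (λ v → b v k)) (cong ((n C k) *_) (∑b≡a∘suc k))))) ⟩
  (∑[ k < suc n ] (n C k) * a k) + (∑[ k < suc n ] (n C k) * a (suc k))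
    ≡⟨ ∑-pascal n a ⟩
  ∑[ k < suc (suc n) ] (suc n C k) * a k ∎
  where
  z = zeroV l
  _+ᵛ_ : Vec ℕ l → Vec ℕ l → Vec ℕ l
  _+ᵛ_ = zipWith _+_
  a : ℕ → ℕ
  a k = ∑[ t ∈ tuples k vs ] g (vsum t)
  b : Vec ℕ l → ℕ → ℕ
  b v k = ∑[ t ∈ tuples k vs ] g (v +ᵛ vsum t)
  ∑b≡a∘suc : ∀ k → ∑[ v ∈ vs ] b v k ≡ a (suc k)
  ∑b≡a∘suc k = sym (∑-tuples k vs (g ∘ vsum))

∑-tuples-nonempty-vanishes : ∀ k (vs : List (Vec ℕ l)) → All Nonempty vs → (g : Vec ℕ l → ℕ) →
  (∀ m → k ≤ Vec.sum m → g m ≡ 0) → ∑[ t ∈ tuples k vs ] g (vsum t) ≡ 0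
∑-tuples-nonempty-vanishes {l} zero vs nz g g-vanishes = cong (_+ 0) (g-vanishes (zeroV l) z≤n)
∑-tuples-nonempty-vanishes (suc k) vs nz g g-vanishes = trans (∑-tuples k vs _)
  (∑-zeroᴬ nz (λ v v≠0 → ∑-tuples-nonempty-vanishes k vs nz (g ∘ zipWith _+_ v)
     (λ m k≤m → g-vanishes (zipWith _+_ v m)
        (subst (suc k ≤_) (sym (sum-zipWith-+ v m)) (+-mono-≤ v≠0 k≤m)))))

ordStirling≡∑ : (d : Vec ℕ l) (k : ℕ) →
  ordStirling d k ≡ ∑[ t ∈ tuples k (box⁺ d) ] 𝟙 (vsum t ≟V d)
ordStirling≡∑ {l} d k = begin
  ordStirling d k
    ≡⟨ length-filter (isOrdPart? d) (tuples k (box d)) ⟩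
  ∑[ s ∈ tuples k (box d) ] 𝟙 (isOrdPart? d s)
    ≡⟨ ∑-cong (tuples k (box d)) (λ s → 𝟙-× (allNonempty? s) (vsum s ≟V d)) ⟩
  ∑[ s ∈ tuples k (box d) ] 𝟙 (allNonempty? s) * 𝟙 (vsum s ≟V d)
    ≡⟨ cong (λ vs → ∑[ s ∈ tuples k vs ] 𝟙 (allNonempty? s) * 𝟙 (vsum s ≟V d)) (box≡zeroV∷box⁺ d) ⟩
  ∑[ s ∈ tuples k (zeroV l ∷ box⁺ d) ] 𝟙 (allNonempty? s) * 𝟙 (vsum s ≟V d)
    ≡⟨ ∑-tuples-nonempty k (box⁺ d) (box⁺-nonempty d) (λ s → 𝟙 (vsum s ≟V d)) ⟩
  ∑[ t ∈ tuples k (box⁺ d) ] 𝟙 (vsum t ≟V d) ∎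

ordStirling-zero : (d : Vec ℕ l) → 1 ≤ Vec.sum d → ordStirling d 0 ≡ 0
ordStirling-zero {l} d 1≤d = trans (ordStirling≡∑ d 0)
  (cong (_+ 0) (𝟙-no (zeroV l ≟V d) (Nonempty⇒≢zeroV d 1≤d ∘ sym)))

ordStirling-vanishes : (d : Vec ℕ l) (k : ℕ) → Vec.sum d < k → ordStirling d k ≡ 0
ordStirling-vanishes d k d<k = trans (ordStirling≡∑ d k)
  (∑-tuples-nonempty-vanishes k (box⁺ d) (box⁺-nonempty d) _ (λ m k≤m →
    𝟙-no (m ≟V d) (λ m≡d → <⇒≱ d<k (subst (λ v → _ ≤ Vec.sum v) m≡d k≤m))))

weakCompositions≡∑ordStirling : (d : Vec ℕ l) (n : ℕ) →
  weakCompositions d n ≡ ∑[ k < suc n ] (n C k) * ordStirling d k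
weakCompositions≡∑ordStirling {l} d n = begin
  weakCompositions d n
    ≡⟨ cong (λ vs → ∑[ s ∈ tuples n vs ] 𝟙 (vsum s ≟V d)) (box≡zeroV∷box⁺ d) ⟩
  ∑[ s ∈ tuples n (zeroV l ∷ box⁺ d) ] 𝟙 (vsum s ≟V d)
    ≡⟨ ∑-tuples-zeroV∷ n (box⁺ d) (λ m → 𝟙 (m ≟V d)) ⟩
  ∑[ k < suc n ] (n C k) * (∑[ t ∈ tuples k (box⁺ d) ] 𝟙 (vsum t ≟V d))
    ≡⟨ ∑<-cong (suc n) (λ k → cong ((n C k) *_) (sym (ordStirling≡∑ d k))) ⟩
  ∑[ k < suc n ] (n C k) * ordStirling d k ∎

theorem4 : (l : ℕ) → l ≥ 1 → (ds : Vec ℕ l) → Vec.sum ds ≥ 1 →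
    (x : ℕ) →
    product (map (λ dj → (x + dj) C dj) (toList ds))
    ≡ sum (map (λ k → ordStirling ds k * ((x + 1) C k)) (map suc (upTo (Vec.sum ds))))
theorem4 l _ ds D≥1 x = begin
  product (map (λ dj → (x + dj) C dj) (toList ds))
    ≡⟨ cong product (map-cong (λ c → sym (boundedCompositions≡C x c c ≤-refl)) (toList ds)) ⟩
  product (map (λ c → boundedCompositions c n c) (toList ds))
    ≡⟨ sym (weakCompositions≡product ds n) ⟩
  weakCompositions ds n
    ≡⟨ weakCompositions≡∑ordStirling ds n ⟩
  ∑< (suc n) F
    ≡⟨ ∑<-support (suc n) (suc D) F (λ k n<k → cong (_* ordStirling ds k) (k>n⇒nCk≡0 n<k))
                                    (λ k D<k → trans (cong ((n C k) *_) (ordStirling-vanishes ds k D<k)) (*-zeroʳ (n C k))) ⟩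
  F 0 + (∑[ k < D ] F (suc k))
    ≡⟨ cong (_+ (∑[ k < D ] F (suc k))) (cong ((n C 0) *_) (ordStirling-zero ds D≥1)) ⟩
  ∑[ k < D ] (n C suc k) * ordStirling ds (suc k)
    ≡⟨ ∑<-cong D (λ k → trans (*-comm (n C suc k) _) (cong (λ m → ordStirling ds (suc k) * (m C suc k)) (+-comm 1 x))) ⟩
  ∑[ k < D ] ordStirling ds (suc k) * ((x + 1) C suc k)
    ≡⟨ sym (trans (∑-map (upTo D) suc _) (∑-applyUpTo D id _)) ⟩
  sum (map (λ k → ordStirling ds k * ((x + 1) C k)) (map suc (upTo D))) ∎
  where
  n = suc x
  D = Vec.sum ds
  F : ℕ → ℕ
  F k = (n C k) * ordStirling ds k
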